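{- Every digraph that has sign symmetric $P_0^+$-completion also has sign symmetric $P$-completion.
   Context: For a real $n\times n$ matrix: a $P$-matrix has all principal minors positive; a $P_0^+$-matrix is one where for every $k\in\{1,\dots,n\}$ all $k\times k$ principal minors are nonnegative and at least one is positive. A matrix is sign symmetric if for all $i\neq j$ either $a_{ij}a_{ji}>0$ or $a_{ij}=a_{ji}=0$ (twin entries). A partial matrix has some entries specified (real numbers) and others unspecified; a completion assigns real values to the unspecified entries; a principal submatrix is fully specified if all its entries are specified. A partial sign symmetric $P$-matrix is a partial matrix every fully specified principal submatrix of which is a sign symmetric $P$-matrix and whose pairs of fully specified twin entries have positive product or are both zero. A partial sign symmetric $P_0^+$-matrix is a partial matrix whose fully specified principal minors are nonnegative and whose pairs of fully specified twin entries have positive product or are both zero, and which, if all its entries are specified, is a sign symmetric $P_0^+$-matrix. A partial $n\times n$ matrix specifies a digraph $D$ on $\{1,\dots,n\}$ (loops allowed) if entry $(i,j)$ (including $i=j$) is specified iff $(i,j)$ is an arc of $D$. For a class $\mathcal{X}$, a digraph $D$ has sign symmetric $\mathcal{X}$-completion if every partial sign symmetric $\mathcal{X}$-matrix specifying $D$ has a completion which is a sign symmetric $\mathcal{X}$-matrix. -}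

module Defs where

open import Level using (0ℓ)
open import Data.Bool using (Bool; true; false; T)
open import Data.Nat as ℕ using (ℕ; zero; suc)
open import Data.Fin as Fin using (Fin; zero; suc; punchIn)
open import Data.Product using (Σ; ∃; ∃-syntax; Σ-syntax; _×_; _,_)
open import Data.Sum using (_⊎_)
open import Relation.Nullary using (¬_)
open import Relation.Binary using (Trichotomous)
open import Relation.Binary.PropositionalEquality using (_≡_; _≢_)
open import Algebra.Structures using (IsCommutativeRing)

-- The real numbers, given axiomatically as a complete ordered field
-- (any two such structures are isomorphic, so quantifying over all of
-- them is the same as speaking about ℝ).

record RealField : Set₁ where
  infixl 6 _+_
  infixl 7 _*_
  infix  4 _<_ _≤_
  field
    Carrier : Set
    _+_ _*_ : Carrier → Carrier → Carrier
    -_      : Carrier → Carrier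
    0# 1#   : Carrier
    _<_     : Carrier → Carrier → Set
    isCommutativeRing : IsCommutativeRing _≡_ _+_ _*_ -_ 0# 1#
    0≢1     : 0# ≢ 1#
    inverse : ∀ x → x ≢ 0# → ∃[ y ] (x * y ≡ 1#)
    <-trans : ∀ {x y z} → x < y → y < z → x < z
    <-tri   : Trichotomous _≡_ _<_
    +-mono-< : ∀ {x y} z → x < y → x + z < y + z
    *-pos   : ∀ {x y} → 0# < x → 0# < y → 0# < x * y

  _≤_ : Carrier → Carrier → Set
  x ≤ y = x < y ⊎ x ≡ y

  field
    lub : (S : Carrier → Set) → (∃[ x ] S x) →
          (∃[ b ] (∀ x → S x → x ≤ b)) →
          ∃[ s ] ((∀ x → S x → x ≤ s) × (∀ b → (∀ x → S x → x ≤ b) → s ≤ b))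

module Over (R : RealField) where
  open RealField R

  Matrix : ℕ → Set
  Matrix n = Fin n → Fin n → Carrier

  altSum : ∀ {n} → (Fin n → Carrier) → Carrier
  altSum {zero}  f = 0#
  altSum {suc n} f = f zero + - altSum (λ j → f (suc j))

  det : ∀ {n} → Matrix n → Carrier
  det {zero}  A = 1#
  det {suc n} A = altSum (λ j → A zero j * det (λ k l → A (suc k) (punchIn j l)))

  StrictlyIncreasing : ∀ {k n} → (Fin k → Fin n) → Set
  StrictlyIncreasing σ = ∀ i j → i Fin.< j → σ i Fin.< σ j

  principal : ∀ {k n} → Matrix n → (Fin k → Fin n) → Matrix k
  principal A σ i j = A (σ i) (σ j)

  -- all principal minors positive (k ranges over 1..n)
  IsP : ∀ {n} → Matrix n → Set
  IsP {n} A = ∀ k (σ : Fin (suc k) → Fin n) → StrictlyIncreasing σ →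
              0# < det (principal A σ)

  IsP0+ : ∀ {n} → Matrix n → Set
  IsP0+ {n} A = ∀ k → suc k ℕ.≤ n →
      (∀ (σ : Fin (suc k) → Fin n) → StrictlyIncreasing σ → 0# ≤ det (principal A σ))
    × (Σ[ σ ∈ (Fin (suc k) → Fin n) ] (StrictlyIncreasing σ × (0# < det (principal A σ))))

  TwinOK : Carrier → Carrier → Set
  TwinOK a b = (0# < a * b) ⊎ (a ≡ 0# × b ≡ 0#)

  SignSymmetric : ∀ {n} → Matrix n → Set
  SignSymmetric A = ∀ i j → i ≢ j → TwinOK (A i j) (A j i)

  -- digraph on {1..n} (loops allowed): arc relation
  Digraph : ℕ → Set
  Digraph n = Fin n → Fin n → Bool

  -- a partial matrix specifying D: values at positions (i,j) with D i j
  -- are the specified entries; the values elsewhere are irrelevant.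
  Completion : ∀ {n} → Digraph n → Matrix n → Matrix n → Set
  Completion D A B = ∀ i j → T (D i j) → B i j ≡ A i j

  FullySpecified : ∀ {k n} → Digraph n → (Fin k → Fin n) → Set
  FullySpecified D σ = ∀ i j → T (D (σ i) (σ j))

  AllSpecified : ∀ {n} → Digraph n → Set
  AllSpecified D = ∀ i j → T (D i j)

  TwinsOK : ∀ {n} → Digraph n → Matrix n → Set
  TwinsOK D A = ∀ i j → i ≢ j → T (D i j) → T (D j i) → TwinOK (A i j) (A j i)

  PartialSSP : ∀ {n} → Digraph n → Matrix n → Set
  PartialSSP {n} D A =
      (∀ k (σ : Fin k → Fin n) → StrictlyIncreasing σ → FullySpecified D σ →
         SignSymmetric (principal A σ) × IsP (principal A σ))
    × TwinsOK D A

  PartialSSP0+ : ∀ {n} → Digraph n → Matrix n → Set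
  PartialSSP0+ {n} D A =
      (∀ k (σ : Fin (suc k) → Fin n) → StrictlyIncreasing σ → FullySpecified D σ →
         0# ≤ det (principal A σ))
    × TwinsOK D A
    × (AllSpecified D → SignSymmetric A × IsP0+ A)

  HasSSPCompletion : ∀ {n} → Digraph n → Set
  HasSSPCompletion D = ∀ A → PartialSSP D A →
    ∃[ B ] (Completion D A B × SignSymmetric B × IsP B)

  HasSSP0+Completion : ∀ {n} → Digraph n → Set
  HasSSP0+Completion D = ∀ A → PartialSSP0+ D A →
    ∃[ B ] (Completion D A B × SignSymmetric B × IsP0+ B)

-- Let A be a partial sign symmetric P-matrix specifying D; its fully specified principal minors are
-- positive. Subtracting ε from a diagonal entry changes a principal minor through that position by
-- -ε times the complementary principal minor, which is again fully specified, so for small ε > 0 all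
-- fully specified minors stay positive. Doing this at every diagonal position yields d > 0 such that
-- A - diag d is a partial sign symmetric P₀⁺-matrix with the off-diagonal entries of A. Complete it
-- to a sign symmetric P₀⁺-matrix B. Then B + diag d completes A, is sign symmetric, and is a
-- P-matrix: adding a positive diagonal to a matrix with nonnegative principal minors makes every
-- principal minor positive, as one sees by adding the diagonal one entry at a time.

module Submission where

open import Defs
open import Level using (0ℓ)
open import Algebra.Bundles using (CommutativeRing; RawRing)
open import Algebra.Solver.Ring.AlmostCommutativeRing
  using (fromCommutativeRing; _-Raw-AlmostCommutative⟶_)
import Algebra.Solver.Ring
import Algebra.Solver.CommutativeMonoid as CommutativeMonoidSolver
import Algebra.Solver.Ring.NaturalCoefficients.Default as NaturalCoefficientSolver
import Algebra.Properties.Semiring.Mult as SemiringMult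
import Algebra.Properties.Semiring.Sum as SemiringSum
import Algebra.Properties.Ring as RingProperties
import Algebra.Properties.AbelianGroup as AbelianGroupProperties
import Algebra.Properties.Group as GroupProperties
open import Data.Nat as ℕ using (ℕ; zero; suc; s≤s)
import Data.Nat.Properties as ℕ
open import Data.Fin as Fin using (Fin; zero; suc; punchIn; pinch; inject≤)
import Data.Fin.Properties as Fin
import Data.Vec.Functional as Vector
open Vector using (updateAt)
open import Data.Vec.Functional.Properties using (updateAt-updates; updateAt-minimal)
open import Data.List using (List; []; _∷_; allFin)
open import Data.List.Membership.Propositional using (_∈_; _∉_)
open import Data.List.Membership.Propositional.Properties using (∈-allFin)
open import Data.List.Relation.Unary.Any using (here; there)
open import Data.Product using (_×_; _,_; proj₁; proj₂; ∃-syntax)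
import Data.Product.Properties as Product
open import Data.Sum using (_⊎_; inj₁; inj₂; reduce)
import Data.Sum as Sum
open import Data.Maybe using (Maybe; just; nothing)
open import Data.Bool using (T)
open import Function using (_∘_; id; const)
open import Relation.Nullary using (¬_; Dec; yes; no; contradiction)
open import Relation.Binary using (tri<; tri≈; tri>)
import Relation.Binary.PropositionalEquality as ≡
open ≡ using (_≡_)
import Relation.Binary.Reasoning.Setoid as SetoidReasoning

-- The ring solver with the ring's own elements as coefficients cannot decide coefficient equalities
-- such as (-1)·(-1) = 1; with integer coefficients it proves all commutative ring identities.
module IntegerCoefficientRingSolver {c ℓ} (CR : CommutativeRing c ℓ) where
  open CommutativeRing CR
  open SemiringMult semiring using (×-homo-+; ×1-homo-*) renaming (_×_ to _·_)
  open RingProperties ring using (-‿distribˡ-*; -‿distribʳ-*)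
  open AbelianGroupProperties +-abelianGroup using (⁻¹-∙-comm)
  open GroupProperties +-group using (ε⁻¹≈ε; ⁻¹-involutive)
  open CommutativeMonoidSolver +-commutativeMonoid using (_⊕_; _⊜_)
    renaming (solve to +-solve)
  open NaturalCoefficientSolver commutativeSemiring using (_:+_; _:*_; _:=_)
    renaming (solve to semiring-solve)
  open SetoidReasoning setoid

  private
    -- (a , b) stands for the integer a - b; canonical representatives have a ≡ 0 or b ≡ 0,
    -- so that syntactic equality of coefficients is equality of integers.
    canonical : ℕ → ℕ → ℕ × ℕ
    canonical zero    b       = 0 , b
    canonical (suc a) zero    = suc a , 0
    canonical (suc a) (suc b) = canonical a b

    ℤ-rawRing : RawRing 0ℓ 0ℓ
    ℤ-rawRing = record
      { Carrier = ℕ × ℕ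
      ; _≈_     = _≡_
      ; _+_     = λ { (a , b) (c , d) → canonical (a ℕ.+ c) (b ℕ.+ d) }
      ; _*_     = λ { (a , b) (c , d) → canonical (a ℕ.* c ℕ.+ b ℕ.* d) (a ℕ.* d ℕ.+ b ℕ.* c) }
      ; -_      = λ { (a , b) → b , a }
      ; 0#      = 0 , 0
      ; 1#      = 1 , 0
      }

    ⟦_⟧ℤ : ℕ × ℕ → Carrier
    ⟦ a , b ⟧ℤ = a · 1# + - (b · 1#)

    -‿+ : ∀ x y → - (x + y) ≈ - x + - y
    -‿+ x y = sym (⁻¹-∙-comm x y)

    1+x-1+y : ∀ x y → (1# + x) + - (1# + y) ≈ x + - y
    1+x-1+y x y = begin
      (1# + x) + - (1# + y)     ≈⟨ +-congˡ (-‿+ 1# y) ⟩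
      (1# + x) + (- 1# + - y)   ≈⟨ +-solve 4 (λ a b c d → (a ⊕ b) ⊕ (c ⊕ d) ⊜ (b ⊕ d) ⊕ (a ⊕ c))
                                             refl 1# x (- 1#) (- y) ⟩
      (x + - y) + (1# + - 1#)   ≈⟨ +-congˡ (-‿inverseʳ 1#) ⟩
      (x + - y) + 0#            ≈⟨ +-identityʳ _ ⟩
      x + - y                   ∎

    ⟦canonical⟧ : ∀ a b → ⟦ canonical a b ⟧ℤ ≈ a · 1# + - (b · 1#)
    ⟦canonical⟧ zero    b       = refl
    ⟦canonical⟧ (suc a) zero    = refl
    ⟦canonical⟧ (suc a) (suc b) = trans (⟦canonical⟧ a b) (sym (1+x-1+y (a · 1#) (b · 1#)))

    +-homo : ∀ x y → ⟦ RawRing._+_ ℤ-rawRing x y ⟧ℤ ≈ ⟦ x ⟧ℤ + ⟦ y ⟧ℤ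
    +-homo (a , b) (c , d) = begin
      ⟦ canonical (a ℕ.+ c) (b ℕ.+ d) ⟧ℤ       ≈⟨ ⟦canonical⟧ (a ℕ.+ c) (b ℕ.+ d) ⟩
      (a ℕ.+ c) · 1# + - ((b ℕ.+ d) · 1#)     ≈⟨ +-cong (×-homo-+ 1# a c) (-‿cong (×-homo-+ 1# b d)) ⟩
      (a′ + c′) + - (b′ + d′)                 ≈⟨ +-congˡ (-‿+ b′ d′) ⟩
      (a′ + c′) + (- b′ + - d′)
        ≈⟨ +-solve 4 (λ a c b d → (a ⊕ c) ⊕ (b ⊕ d) ⊜ (a ⊕ b) ⊕ (c ⊕ d)) refl a′ c′ (- b′) (- d′) ⟩
      (a′ + - b′) + (c′ + - d′)               ∎
      where a′ = a · 1#; b′ = b · 1#; c′ = c · 1#; d′ = d · 1#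

    *-homo : ∀ x y → ⟦ RawRing._*_ ℤ-rawRing x y ⟧ℤ ≈ ⟦ x ⟧ℤ * ⟦ y ⟧ℤ
    *-homo (a , b) (c , d) = begin
      ⟦ canonical (a ℕ.* c ℕ.+ b ℕ.* d) (a ℕ.* d ℕ.+ b ℕ.* c) ⟧ℤ
        ≈⟨ ⟦canonical⟧ (a ℕ.* c ℕ.+ b ℕ.* d) (a ℕ.* d ℕ.+ b ℕ.* c) ⟩
      (a ℕ.* c ℕ.+ b ℕ.* d) · 1# + - ((a ℕ.* d ℕ.+ b ℕ.* c) · 1#)
        ≈⟨ +-cong (·1#-+* a c b d) (-‿cong (·1#-+* a d b c)) ⟩
      (a′ * c′ + b′ * d′) + - (a′ * d′ + b′ * c′)
        ≈⟨ +-congˡ (-‿+ (a′ * d′) (b′ * c′)) ⟩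
      (a′ * c′ + b′ * d′) + (- (a′ * d′) + - (b′ * c′))
        ≈⟨ +-cong (+-congˡ (sym (-x*-y b′ d′))) (+-cong (-‿distribʳ-* a′ d′) (-‿distribˡ-* b′ c′)) ⟩
      (a′ * c′ + - b′ * - d′) + (a′ * - d′ + - b′ * c′)
        ≈⟨ semiring-solve 4 (λ a b c d → (a :* c :+ b :* d) :+ (a :* d :+ b :* c) := (a :+ b) :* (c :+ d))
                            refl a′ (- b′) c′ (- d′) ⟩
      (a′ + - b′) * (c′ + - d′)
        ∎
      where
        a′ = a · 1#; b′ = b · 1#; c′ = c · 1#; d′ = d · 1#
        ·1#-+* : ∀ a c b d → (a ℕ.* c ℕ.+ b ℕ.* d) · 1# ≈ (a · 1#) * (c · 1#) + (b · 1#) * (d · 1#)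
        ·1#-+* a c b d = trans (×-homo-+ 1# (a ℕ.* c) (b ℕ.* d)) (+-cong (×1-homo-* a c) (×1-homo-* b d))
        -x*-y : ∀ x y → - x * - y ≈ x * y
        -x*-y x y = trans (sym (-‿distribˡ-* x (- y)))
                          (trans (-‿cong (sym (-‿distribʳ-* x y))) (⁻¹-involutive (x * y)))

    -‿homo : ∀ x → ⟦ RawRing.-_ ℤ-rawRing x ⟧ℤ ≈ - ⟦ x ⟧ℤ
    -‿homo (a , b) = sym (begin
      - (a · 1# + - (b · 1#))      ≈⟨ -‿+ _ _ ⟩
      - (a · 1#) + - - (b · 1#)    ≈⟨ +-congˡ (⁻¹-involutive _) ⟩
      - (a · 1#) + b · 1#          ≈⟨ +-comm _ _ ⟩
      b · 1# + - (a · 1#)          ∎)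

    homomorphism : ℤ-rawRing -Raw-AlmostCommutative⟶ fromCommutativeRing CR
    homomorphism = record
      { ⟦_⟧    = ⟦_⟧ℤ
      ; +-homo = +-homo
      ; *-homo = *-homo
      ; -‿homo = -‿homo
      ; 0-homo = trans (+-congˡ ε⁻¹≈ε) (+-identityʳ 0#)
      ; 1-homo = trans (+-cong (+-identityʳ 1#) ε⁻¹≈ε) (+-identityʳ 1#)
      }

    _≟ℤ_ : ∀ x y → Maybe (⟦ x ⟧ℤ ≈ ⟦ y ⟧ℤ)
    x ≟ℤ y with Product.≡-dec ℕ._≟_ ℕ._≟_ x y
    ... | yes ≡.refl = just refl
    ... | no _     = nothing

  open Algebra.Solver.Ring ℤ-rawRing (fromCommutativeRing CR) homomorphism _≟ℤ_ public
    using (solve; _:+_; _:*_; :-_; _:-_; _:=_)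

open ≡ using (_≢_; refl; sym; trans; cong; cong₂; subst; subst₂; module ≡-Reasoning)

module RealFieldProperties (R : RealField) where
  open RealField R

  commutativeRing : CommutativeRing 0ℓ 0ℓ
  commutativeRing = record { isCommutativeRing = isCommutativeRing }

  open CommutativeRing commutativeRing public
    using ( +-assoc; +-comm; +-identityˡ; +-identityʳ; *-identityˡ; *-identityʳ
          ; zeroˡ; zeroʳ; -‿inverseʳ; semiring)
  open RingProperties (CommutativeRing.ring commutativeRing) public using (-‿distribˡ-*; -‿distribʳ-*)
  open GroupProperties (CommutativeRing.+-group commutativeRing) public using (ε⁻¹≈ε)
  open IntegerCoefficientRingSolver commutativeRing public

  -‿+ : ∀ x y → - (x + y) ≡ - x + - y
  -‿+ = solve 2 (λ x y → :- (x :+ y) := :- x :+ :- y) refl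

  <-irrefl : ∀ {x} → ¬ x < x
  <-irrefl {x} with <-tri x x
  ... | tri< _ x≢x _ = λ _ → x≢x refl
  ... | tri≈ x≮x _ _ = x≮x
  ... | tri> _ x≢x _ = λ _ → x≢x refl

  <-asym : ∀ {x y} → x < y → ¬ y < x
  <-asym x<y y<x = <-irrefl (<-trans x<y y<x)

  <⇒≢ : ∀ {x y} → x < y → x ≢ y
  <⇒≢ x<x refl = <-irrefl x<x

  0<? : ∀ x → Dec (0# < x)
  0<? x with <-tri 0# x
  ... | tri< 0<x _ _ = yes 0<x
  ... | tri≈ 0≮x _ _ = no 0≮x
  ... | tri> 0≮x _ _ = no 0≮x

  x<y⇒0<y-x : ∀ {x y} → x < y → 0# < y + - x
  x<y⇒0<y-x {x} {y} x<y = subst (_< y + - x) (-‿inverseʳ x) (+-mono-< (- x) x<y)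

  0<y-x⇒x<y : ∀ {x y} → 0# < y + - x → x < y
  0<y-x⇒x<y {x} {y} 0<y-x =
    subst₂ _<_ (+-identityˡ x) (solve 2 (λ y x → y :- x :+ x := y) refl y x) (+-mono-< x 0<y-x)

  x<0⇒0<-x : ∀ {x} → x < 0# → 0# < - x
  x<0⇒0<-x {x} x<0 = subst (0# <_) (+-identityˡ (- x)) (x<y⇒0<y-x x<0)

  x<x+y : ∀ {x y} → 0# < y → x < x + y
  x<x+y {x} {y} 0<y = subst₂ _<_ (+-identityˡ x) (+-comm y x) (+-mono-< x 0<y)

  0<1 : 0# < 1#
  0<1 with <-tri 0# 1#
  ... | tri< 0<1 _ _ = 0<1
  ... | tri≈ _ 0≡1 _ = contradiction 0≡1 0≢1
  ... | tri> _ _ 1<0 = contradiction 1<0 (<-asym (subst (0# <_) -1*-1≡1 (*-pos 0<-1 0<-1)))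
    where
      0<-1 = x<0⇒0<-x 1<0
      -1*-1≡1 : - 1# * - 1# ≡ 1#
      -1*-1≡1 = trans (solve 1 (λ x → :- x :* :- x := x :* x) refl 1#) (*-identityʳ 1#)

  +-pos : ∀ {x y} → 0# < x → 0# < y → 0# < x + y
  +-pos 0<x 0<y = <-trans 0<x (x<x+y 0<y)

  +-nonNeg-pos : ∀ {x y} → 0# ≤ x → 0# < y → 0# < x + y
  +-nonNeg-pos (inj₁ 0<x) 0<y = +-pos 0<x 0<y
  +-nonNeg-pos {y = y} (inj₂ refl) 0<y = subst (0# <_) (sym (+-identityˡ y)) 0<y

  +-nonNeg : ∀ {x y} → 0# ≤ x → 0# ≤ y → 0# ≤ x + y
  +-nonNeg 0≤x (inj₁ 0<y) = inj₁ (+-nonNeg-pos 0≤x 0<y)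
  +-nonNeg {x} 0≤x (inj₂ refl) = subst (0# ≤_) (sym (+-identityʳ x)) 0≤x

  *-nonNeg : ∀ {x y} → 0# ≤ x → 0# ≤ y → 0# ≤ x * y
  *-nonNeg (inj₁ 0<x) (inj₁ 0<y) = inj₁ (*-pos 0<x 0<y)
  *-nonNeg {x} _ (inj₂ refl) = inj₂ (sym (zeroʳ x))
  *-nonNeg {y = y} (inj₂ refl) (inj₁ _) = inj₂ (sym (zeroˡ y))

  *-monoʳ-< : ∀ {x y z} → 0# < z → x < y → x * z < y * z
  *-monoʳ-< {x} {y} {z} 0<z x<y = 0<y-x⇒x<y (subst (0# <_)
    (solve 3 (λ x y z → (y :- x) :* z := y :* z :- x :* z) refl x y z) (*-pos (x<y⇒0<y-x x<y) 0<z))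

  inverse-pos : ∀ {x y} → 0# < x → x * y ≡ 1# → 0# < y
  inverse-pos {x} {y} 0<x xy≡1 with <-tri 0# y
  ... | tri< 0<y _ _ = 0<y
  ... | tri≈ _ refl _ = contradiction (trans (sym (zeroʳ x)) xy≡1) 0≢1
  ... | tri> _ _ y<0 = contradiction (+-pos 0<1 0<-1) (subst (λ z → ¬ 0# < z) (sym (-‿inverseʳ 1#)) <-irrefl)
    where
      0<-1 : 0# < - 1#
      0<-1 = subst (0# <_) (trans (sym (-‿distribʳ-* x y)) (cong -_ xy≡1)) (*-pos 0<x (x<0⇒0<-x y<0))

  0<1+1 : 0# < 1# + 1#
  0<1+1 = +-pos 0<1 0<1

  ∃-smaller-pos : ∀ {x} → 0# < x → ∃[ y ] (0# < y × y < x)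
  ∃-smaller-pos {x} 0<x with inverse (1# + 1#) (λ 2≡0 → <⇒≢ 0<1+1 (sym 2≡0))
  ... | h , 2h≡1 = x * h , 0<x/2 , subst (x * h <_) x/2+x/2≡x (x<x+y 0<x/2)
    where
      0<x/2 : 0# < x * h
      0<x/2 = *-pos 0<x (inverse-pos 0<1+1 2h≡1)
      x/2+x/2≡x : x * h + x * h ≡ x
      x/2+x/2≡x = begin
        x * h + x * h                 ≡⟨ cong (λ z → x * z + x * z) (sym (*-identityˡ h)) ⟩
        x * (1# * h) + x * (1# * h)   ≡⟨ solve 3 (λ x h o → x :* (o :* h) :+ x :* (o :* h) := x :* ((o :+ o) :* h))
                                                 refl x h 1# ⟩
        x * ((1# + 1#) * h)           ≡⟨ cong (x *_) 2h≡1 ⟩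
        x * 1#                        ≡⟨ *-identityʳ x ⟩
        x                             ∎
        where open ≡-Reasoning

module SmallParameters (R : RealField) where
  open RealField R
  open RealFieldProperties R

  Eventually : (Carrier → Set) → Set
  Eventually P = ∃[ e ] (0# < e × (∀ ε → 0# < ε → ε < e → P ε))

  eventually-map : ∀ {P Q : Carrier → Set} → (∀ {ε} → P ε → Q ε) → Eventually P → Eventually Q
  eventually-map P⇒Q (e , 0<e , p) = e , 0<e , λ ε 0<ε ε<e → P⇒Q (p ε 0<ε ε<e)

  eventually-always : ∀ {P : Carrier → Set} → (∀ ε → P ε) → Eventually P
  eventually-always p = 1# , 0<1 , λ ε _ _ → p ε

  eventually-× : ∀ {P Q : Carrier → Set} → Eventually P → Eventually Q → Eventually (λ ε → P ε × Q ε)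
  eventually-× (e₁ , 0<e₁ , p) (e₂ , 0<e₂ , q) with <-tri e₁ e₂
  ... | tri< e₁<e₂ _ _ = e₁ , 0<e₁ , λ ε 0<ε ε<e₁ → p ε 0<ε ε<e₁ , q ε 0<ε (<-trans ε<e₁ e₁<e₂)
  ... | tri≈ _ refl _  = e₁ , 0<e₁ , λ ε 0<ε ε<e₁ → p ε 0<ε ε<e₁ , q ε 0<ε ε<e₁
  ... | tri> _ _ e₂<e₁ = e₂ , 0<e₂ , λ ε 0<ε ε<e₂ → p ε 0<ε (<-trans ε<e₂ e₂<e₁) , q ε 0<ε ε<e₂

  eventually-∀Fin : ∀ {n} {P : Fin n → Carrier → Set} →
                    (∀ i → Eventually (P i)) → Eventually (λ ε → ∀ i → P i ε)
  eventually-∀Fin {zero}  _  = eventually-always (λ _ ())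
  eventually-∀Fin {suc n} ev = eventually-map (λ { (p₀ , p) zero → p₀ ; (p₀ , p) (suc i) → p i })
    (eventually-× (ev zero) (eventually-∀Fin (ev ∘ suc)))

  eventually-∀Fin→Fin : ∀ k {n} {P : (Fin k → Fin n) → Carrier → Set} →
                        (∀ {σ τ ε} → (∀ i → σ i ≡ τ i) → P σ ε → P τ ε) →
                        (∀ σ → Eventually (P σ)) → Eventually (λ ε → ∀ σ → P σ ε)
  eventually-∀Fin→Fin zero    resp ev = eventually-map (λ p σ → resp (λ ()) p) (ev (λ ()))
  eventually-∀Fin→Fin (suc k) resp ev = eventually-map
    (λ p σ → resp (λ { zero → refl ; (suc i) → refl }) (p (σ zero) (σ ∘ suc)))
    (eventually-∀Fin (λ h → eventually-∀Fin→Fin k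
      (λ σ≗τ → resp (λ { zero → refl ; (suc i) → σ≗τ i })) (λ τ → ev (h Vector.∷ τ))))

  eventually-∀< : ∀ N {P : ℕ → Carrier → Set} →
                  (∀ k → Eventually (P k)) → Eventually (λ ε → ∀ k → k ℕ.< N → P k ε)
  eventually-∀< zero    _  = eventually-always (λ _ _ ())
  eventually-∀< (suc N) {P} ev = eventually-map below (eventually-× (ev N) (eventually-∀< N ev))
    where
      below : ∀ {ε} → P N ε × (∀ k → k ℕ.< N → P k ε) → ∀ k → k ℕ.< suc N → P k ε
      below (pN , p<N) k k<1+N with ℕ.m<1+n⇒m<n∨m≡n k<1+N
      ... | inj₁ k<N  = p<N k k<N
      ... | inj₂ refl = pN

  eventually-witness : ∀ {P : Carrier → Set} → Eventually P → ∃[ ε ] (0# < ε × P ε)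
  eventually-witness (e , 0<e , p) =
    let ε , 0<ε , ε<e = ∃-smaller-pos 0<e in ε , 0<ε , p ε 0<ε ε<e

  eventually-*-< : ∀ {x y} → 0# < x → 0# < y → Eventually (λ ε → ε * y < x)
  eventually-*-< {x} {y} 0<x 0<y with inverse y (λ y≡0 → <⇒≢ 0<y (sym y≡0))
  ... | y⁻¹ , yy⁻¹≡1 = x * y⁻¹ , *-pos 0<x (inverse-pos 0<y yy⁻¹≡1) ,
    λ ε _ ε<x/y → subst (ε * y <_) x/y*y≡x (*-monoʳ-< 0<y ε<x/y)
    where
      x/y*y≡x : x * y⁻¹ * y ≡ x
      x/y*y≡x = begin
        x * y⁻¹ * y    ≡⟨ solve 3 (λ x y z → x :* z :* y := x :* (y :* z)) refl x y y⁻¹ ⟩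
        x * (y * y⁻¹)  ≡⟨ cong (x *_) yy⁻¹≡1 ⟩
        x * 1#         ≡⟨ *-identityʳ x ⟩
        x              ∎
        where open ≡-Reasoning

  eventually-0<x-εy : ∀ x y → Eventually (λ ε → 0# < x → 0# < y → 0# < x + - ε * y)
  eventually-0<x-εy x y with 0<? x | 0<? y
  ... | yes 0<x | yes 0<y = eventually-map
    (λ {ε} εy<x _ _ → subst (λ z → 0# < x + z) (-‿distribˡ-* ε y) (x<y⇒0<y-x εy<x))
    (eventually-*-< 0<x 0<y)
  ... | no 0≮x | _       = eventually-always (λ _ 0<x _ → contradiction 0<x 0≮x)
  ... | _      | no 0≮y  = eventually-always (λ _ _ 0<y → contradiction 0<y 0≮y)

module IndexSelections (R : RealField) where
  open Over R using (StrictlyIncreasing; FullySpecified; Digraph)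

  strictlyIncreasing⇒injective : ∀ {k n} {σ : Fin k → Fin n} → StrictlyIncreasing σ →
                                 ∀ {a b} → σ a ≡ σ b → a ≡ b
  strictlyIncreasing⇒injective σ↑ {a} {b} σa≡σb with Fin.<-cmp a b
  ... | tri< a<b _ _ = contradiction σa≡σb (Fin.<⇒≢ (σ↑ a b a<b))
  ... | tri≈ _ a≡b _ = a≡b
  ... | tri> _ _ b<a = contradiction (sym σa≡σb) (Fin.<⇒≢ (σ↑ b a b<a))

  strictlyIncreasing-id : ∀ {n} → StrictlyIncreasing {n} id
  strictlyIncreasing-id _ _ i<j = i<j

  strictlyIncreasing-∘ : ∀ {k m n} {σ : Fin m → Fin n} {τ : Fin k → Fin m} →
                         StrictlyIncreasing σ → StrictlyIncreasing τ → StrictlyIncreasing (σ ∘ τ)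
  strictlyIncreasing-∘ σ↑ τ↑ i j i<j = σ↑ _ _ (τ↑ i j i<j)

  strictlyIncreasing-punchIn : ∀ {n} (x : Fin (suc n)) → StrictlyIncreasing (punchIn x)
  strictlyIncreasing-punchIn x i j i<j = Fin.≤∧≢⇒<
    (Fin.punchIn-mono-≤ x i j (ℕ.<⇒≤ i<j))
    (λ eq → Fin.<⇒≢ i<j (Fin.punchIn-injective x i j eq))

  strictlyIncreasing-inject≤ : ∀ {k n} (k≤n : k ℕ.≤ n) →
                               StrictlyIncreasing (λ (i : Fin k) → inject≤ i k≤n)
  strictlyIncreasing-inject≤ k≤n i j i<j =
    subst₂ ℕ._<_ (sym (Fin.toℕ-inject≤ i k≤n)) (sym (Fin.toℕ-inject≤ j k≤n)) i<j

  strictlyIncreasing⇒≤ : ∀ {k n} {σ : Fin k → Fin n} → StrictlyIncreasing σ → k ℕ.≤ n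
  strictlyIncreasing⇒≤ {k} {n} {σ} σ↑ with k ℕ.≤? n
  ... | yes k≤n = k≤n
  ... | no k≰n with Fin.pigeonhole (ℕ.≰⇒> k≰n) σ
  ...   | i , j , i<j , σi≡σj = contradiction σi≡σj (Fin.<⇒≢ (σ↑ i j i<j))

  strictlyIncreasing-resp-≗ : ∀ {k n} {σ τ : Fin k → Fin n} → (∀ i → σ i ≡ τ i) →
                              StrictlyIncreasing σ → StrictlyIncreasing τ
  strictlyIncreasing-resp-≗ σ≗τ σ↑ i j i<j = subst₂ Fin._<_ (σ≗τ i) (σ≗τ j) (σ↑ i j i<j)

  fullySpecified-resp-≗ : ∀ {k n} {D : Digraph n} {σ τ : Fin k → Fin n} → (∀ i → σ i ≡ τ i) →
                          FullySpecified D σ → FullySpecified D τ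
  fullySpecified-resp-≗ {D = D} σ≗τ σ∈D i j = subst₂ (λ a b → T (D a b)) (σ≗τ i) (σ≗τ j) (σ∈D i j)

module Determinants (R : RealField) where
  open RealField R
  open Over R
  open RealFieldProperties R
  open IndexSelections R
  open SemiringSum semiring using (sum; sum-cong-≗; sum-remove; ∑-distrib-+; *-distribˡ-sum)
  open ≡-Reasoning

  sign : ∀ {n} → Fin n → Carrier
  sign zero    = 1#
  sign (suc i) = - sign i

  sign² : ∀ {n} (i : Fin n) → sign i * sign i ≡ 1#
  sign² zero    = *-identityʳ 1#
  sign² (suc i) = trans (solve 1 (λ s → :- s :* :- s := s :* s) refl (sign i)) (sign² i)

  -‿sum : ∀ {n} (f : Fin n → Carrier) → - sum f ≡ sum (λ j → - f j)
  -‿sum {zero}  f = ε⁻¹≈ε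
  -‿sum {suc n} f = trans (-‿+ (f zero) _) (cong (- f zero +_) (-‿sum (f ∘ suc)))

  altSum≡sum : ∀ {n} (f : Fin n → Carrier) → altSum f ≡ sum (λ j → sign j * f j)
  altSum≡sum {zero}  f = refl
  altSum≡sum {suc n} f = cong₂ _+_ (sym (*-identityˡ (f zero))) (begin
    - altSum (f ∘ suc)                              ≡⟨ cong -_ (altSum≡sum (f ∘ suc)) ⟩
    - sum (λ j → sign j * f (suc j))                ≡⟨ -‿sum (λ j → sign j * f (suc j)) ⟩
    sum (λ j → - (sign j * f (suc j)))              ≡⟨ sum-cong-≗ (λ j → -‿distribˡ-* (sign j) (f (suc j))) ⟩
    sum (λ j → - sign j * f (suc j))                ∎)

  altSum-cong : ∀ {n} {f g : Fin n → Carrier} → (∀ j → f j ≡ g j) → altSum f ≡ altSum g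
  altSum-cong {zero}  _   = refl
  altSum-cong {suc n} f≗g = cong₂ (λ a b → a + - b) (f≗g zero) (altSum-cong (f≗g ∘ suc))

  det-cong : ∀ {n} {M N : Matrix n} → (∀ i j → M i j ≡ N i j) → det M ≡ det N
  det-cong {zero}  _   = refl
  det-cong {suc n} M≗N = altSum-cong λ j →
    cong₂ _*_ (M≗N zero j) (det-cong (λ k l → M≗N (suc k) (punchIn j l)))

  sum-perturb : ∀ {n} {f g : Fin (suc n) → Carrier} {t} c →
                (∀ j → j ≢ c → g j ≡ f j) → g c ≡ f c + t → sum g ≡ sum f + t
  sum-perturb {f = f} {g} {t} c g≗f gc = begin
    sum g                             ≡⟨ sum-remove g ⟩
    g c + sum (g ∘ punchIn c)         ≡⟨ cong₂ _+_ gc (sum-cong-≗ (λ j → g≗f _ (Fin.punchInᵢ≢i c j))) ⟩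
    (f c + t) + sum (f ∘ punchIn c)   ≡⟨ solve 3 (λ a t s → (a :+ t) :+ s := (a :+ s) :+ t) refl (f c) t _ ⟩
    (f c + sum (f ∘ punchIn c)) + t   ≡⟨ cong (_+ t) (sym (sum-remove f)) ⟩
    sum f + t                         ∎

  dropRowCol : ∀ {m} → Fin (suc m) → Fin (suc m) → Matrix (suc m) → Matrix m
  dropRowCol r c M k l = M (punchIn r k) (punchIn c l)

  det-expand : ∀ {m} (M : Matrix (suc m)) →
               det M ≡ sum (λ j → sign j * (M zero j * det (dropRowCol zero j M)))
  det-expand M = altSum≡sum (λ j → M zero j * det (dropRowCol zero j M))

  record AddAt {m} (r c : Fin m) (t : Carrier) (M M′ : Matrix m) : Set where
    field
      elsewhere : ∀ k l → k ≢ r ⊎ l ≢ c → M′ k l ≡ M k l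
      at        : M′ r c ≡ M r c + t
  open AddAt

  dropRowCol-AddAt : ∀ {m} {a b r c : Fin (suc m)} {r′ c′ : Fin m} {t} {M M′ : Matrix (suc m)} →
                     AddAt r c t M M′ → punchIn a r′ ≡ r → punchIn b c′ ≡ c →
                     AddAt r′ c′ t (dropRowCol a b M) (dropRowCol a b M′)
  dropRowCol-AddAt {a = a} {b} {r′ = r′} {c′} δ refl refl = record
    { elsewhere = λ k l k≢r′⊎l≢c′ → elsewhere δ _ _ (Sum.map
        (λ k≢r′ eq → k≢r′ (Fin.punchIn-injective a k r′ eq))
        (λ l≢c′ eq → l≢c′ (Fin.punchIn-injective b l c′ eq)) k≢r′⊎l≢c′)
    ; at        = at δ
    }

  dropRowCol-AddAt-unchanged : ∀ {m} {a b r c : Fin (suc m)} {t} {M M′ : Matrix (suc m)} →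
                               AddAt r c t M M′ → r ≡ a ⊎ c ≡ b →
                               ∀ k l → dropRowCol a b M′ k l ≡ dropRowCol a b M k l
  dropRowCol-AddAt-unchanged {a = a} δ (inj₁ refl) k l = elsewhere δ _ _ (inj₁ (Fin.punchInᵢ≢i a k))
  dropRowCol-AddAt-unchanged {b = b} δ (inj₂ refl) k l = elsewhere δ _ _ (inj₂ (Fin.punchInᵢ≢i b l))

  -- In dropRowCol zero (punchIn c j) M, the column c of M sits at position pinch j c.
  punchIn-punchIn-pinch : ∀ {m} (c : Fin (suc (suc m))) (j : Fin (suc m)) →
                          punchIn (punchIn c j) (pinch j c) ≡ c
  punchIn-punchIn-pinch zero    j       = refl
  punchIn-punchIn-pinch (suc c) zero    = refl
  punchIn-punchIn-pinch {suc m} (suc c) (suc j) = cong suc (punchIn-punchIn-pinch c j)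

  punchIn-punchIn-pinch-punchIn : ∀ {m} (c : Fin (suc (suc m))) (j : Fin (suc m)) (l : Fin m) →
                                  punchIn (punchIn c j) (punchIn (pinch j c) l) ≡ punchIn c (punchIn j l)
  punchIn-punchIn-pinch-punchIn zero    j       l       = refl
  punchIn-punchIn-pinch-punchIn (suc c) zero    l       = refl
  punchIn-punchIn-pinch-punchIn {suc m} (suc c) (suc j) zero    = refl
  punchIn-punchIn-pinch-punchIn {suc m} (suc c) (suc j) (suc l) = cong suc (punchIn-punchIn-pinch-punchIn c j l)

  sign-punchIn-pinch : ∀ {m} (c : Fin (suc (suc m))) (j : Fin (suc m)) →
                       sign (punchIn c j) * sign (pinch j c) ≡ - (sign c * sign j)
  sign-punchIn-pinch zero    j       = solve 2 (λ s o → :- s :* o := :- (o :* s)) refl (sign j) 1#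
  sign-punchIn-pinch (suc c) zero    = solve 2 (λ s o → o :* s := :- (:- s :* o)) refl (sign c) 1#
  sign-punchIn-pinch {suc m} (suc c) (suc j) = begin
    - sign (punchIn c j) * - sign (pinch j c)   ≡⟨ solve 2 (λ a b → :- a :* :- b := a :* b) refl _ _ ⟩
    sign (punchIn c j) * sign (pinch j c)       ≡⟨ sign-punchIn-pinch c j ⟩
    - (sign c * sign j)                         ≡⟨ cong -_ (solve 2 (λ a b → a :* b := :- a :* :- b) refl _ _) ⟩
    - (- sign c * - sign j)                     ∎

  -- Laplace expansion along row zero: if r is zero only the c-th term changes; otherwise the c-th
  -- minor avoids the changed entry and every other minor contains it, at position (r , pinch j c).
  det-AddAt : ∀ {m} {r c : Fin (suc m)} {t} {M M′ : Matrix (suc m)} → AddAt r c t M M′ →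
              det M′ ≡ det M + sign r * sign c * t * det (dropRowCol r c M)
  det-AddAt {r = zero} {c} {t} {M} {M′} δ = begin
    det M′                                        ≡⟨ det-expand M′ ⟩
    sum g                                         ≡⟨ sum-perturb c g≗f gc ⟩
    sum f + sign c * (t * det (dropRowCol zero c M))
      ≡⟨ cong₂ _+_ (sym (det-expand M))
                   (solve 3 (λ s t d → s :* (t :* d) := s :* t :* d) refl (sign c) t _) ⟩
    det M + sign c * t * det (dropRowCol zero c M)
      ≡⟨ cong (λ z → det M + z * t * det (dropRowCol zero c M)) (sym (*-identityˡ (sign c))) ⟩
    det M + 1# * sign c * t * det (dropRowCol zero c M) ∎
    where
      f g : Fin _ → Carrier
      f j = sign j * (M zero j * det (dropRowCol zero j M))
      g j = sign j * (M′ zero j * det (dropRowCol zero j M′))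
      minor-unchanged : ∀ j → det (dropRowCol zero j M′) ≡ det (dropRowCol zero j M)
      minor-unchanged j = det-cong (dropRowCol-AddAt-unchanged δ (inj₁ refl))
      g≗f : ∀ j → j ≢ c → g j ≡ f j
      g≗f j j≢c = cong (sign j *_) (cong₂ _*_ (elsewhere δ zero j (inj₂ j≢c)) (minor-unchanged j))
      gc : g c ≡ f c + sign c * (t * det (dropRowCol zero c M))
      gc = trans (cong (sign c *_) (cong₂ _*_ (at δ) (minor-unchanged c)))
                 (solve 4 (λ s a t d → s :* ((a :+ t) :* d) := s :* (a :* d) :+ s :* (t :* d))
                          refl (sign c) (M zero c) t _)
  det-AddAt {suc m} {suc r} {c} {t} {M} {M′} δ = begin
    det M′                                           ≡⟨ det-expand M′ ⟩
    sum g                                            ≡⟨ sum-remove g ⟩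
    g c + sum (g ∘ punchIn c)                        ≡⟨ cong₂ _+_ gc≡fc (sum-cong-≗ expand-term) ⟩
    f c + sum (λ j → f (punchIn c j) + K * h j)
      ≡⟨ cong (f c +_) (∑-distrib-+ (f ∘ punchIn c) (λ j → K * h j)) ⟩
    f c + (sum (f ∘ punchIn c) + sum (λ j → K * h j))
      ≡⟨ cong (λ z → f c + (sum (f ∘ punchIn c) + z)) (sym (*-distribˡ-sum K h)) ⟩
    f c + (sum (f ∘ punchIn c) + K * sum h)
      ≡⟨ sym (+-assoc _ _ _) ⟩
    (f c + sum (f ∘ punchIn c)) + K * sum h
      ≡⟨ cong₂ (λ a b → a + K * b) (sym (trans (det-expand M) (sum-remove f)))
                                   (sym (det-expand (dropRowCol (suc r) c M))) ⟩
    det M + K * det (dropRowCol (suc r) c M)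
      ∎
    where
      K = sign (suc r) * sign c * t
      f g h : Fin _ → Carrier
      f j = sign j * (M zero j * det (dropRowCol zero j M))
      g j = sign j * (M′ zero j * det (dropRowCol zero j M′))
      h j = sign j * (M zero (punchIn c j) * det (dropRowCol zero j (dropRowCol (suc r) c M)))
      gc≡fc : g c ≡ f c
      gc≡fc = cong (sign c *_) (cong₂ _*_ (elsewhere δ zero c (inj₁ (λ ())))
                                          (det-cong (dropRowCol-AddAt-unchanged {a = zero} δ (inj₂ refl))))
      expand-term : ∀ j → g (punchIn c j) ≡ f (punchIn c j) + K * h j
      expand-term j = begin
        s * (M′ zero (punchIn c j) * det (dropRowCol zero (punchIn c j) M′))
          ≡⟨ cong₂ (λ a b → s * (a * b)) (elsewhere δ zero (punchIn c j) (inj₁ (λ ())))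
                   (det-AddAt (dropRowCol-AddAt {a = zero} {punchIn c j} {r′ = r} {pinch j c}
                                                δ refl (punchIn-punchIn-pinch c j))) ⟩
        s * (m₀ * (d₀ + sign r * p * t * det (dropRowCol r (pinch j c) (dropRowCol zero (punchIn c j) M))))
          ≡⟨ cong (λ z → s * (m₀ * (d₀ + sign r * p * t * z)))
                  (det-cong (λ k l → cong (M (suc (punchIn r k))) (punchIn-punchIn-pinch-punchIn c j l))) ⟩
        s * (m₀ * (d₀ + sign r * p * t * e))
          ≡⟨ solve 7 (λ s p m d r t e → s :* (m :* (d :+ r :* p :* t :* e))
                                      := s :* (m :* d) :+ (s :* p) :* (r :* t :* (m :* e)))
                   refl s p m₀ d₀ (sign r) t e ⟩
        f (punchIn c j) + (s * p) * (sign r * t * (m₀ * e))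
          ≡⟨ cong (λ z → f (punchIn c j) + z * (sign r * t * (m₀ * e))) (sign-punchIn-pinch c j) ⟩
        f (punchIn c j) + - (sign c * sign j) * (sign r * t * (m₀ * e))
          ≡⟨ cong (f (punchIn c j) +_)
                  (solve 6 (λ a b r t m e → :- (a :* b) :* (r :* t :* (m :* e)) := :- r :* a :* t :* (b :* (m :* e)))
                           refl (sign c) (sign j) (sign r) t m₀ e) ⟩
        f (punchIn c j) + K * h j ∎
        where
          s = sign (punchIn c j)
          p = sign (pinch j c)
          m₀ = M zero (punchIn c j)
          d₀ = det (dropRowCol zero (punchIn c j) M)
          e = det (dropRowCol zero j (dropRowCol (suc r) c M))

  det-AddAt-diagonal : ∀ {m} {x : Fin (suc m)} {t} {M M′ : Matrix (suc m)} → AddAt x x t M M′ →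
                       det M′ ≡ det M + t * det (dropRowCol x x M)
  det-AddAt-diagonal {x = x} {t} {M} δ = trans (det-AddAt δ) (cong (det M +_) (begin
    sign x * sign x * t * d     ≡⟨ solve 3 (λ s t d → s :* s :* t :* d := s :* s :* (t :* d)) refl (sign x) t d ⟩
    sign x * sign x * (t * d)   ≡⟨ cong (_* (t * d)) (sign² x) ⟩
    1# * (t * d)                ≡⟨ *-identityˡ (t * d) ⟩
    t * d                       ∎))
    where d = det (dropRowCol x x M)

  principal-AddAt : ∀ {k n} {x : Fin n} {j : Fin k} {t} {M M′ : Matrix n} {σ : Fin k → Fin n} →
                    AddAt x x t M M′ → StrictlyIncreasing σ → σ j ≡ x →
                    AddAt j j t (principal M σ) (principal M′ σ)
  principal-AddAt δ σ↑ refl = record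
    { elsewhere = λ a b a≢j⊎b≢j → elsewhere δ _ _
        (Sum.map (_∘ strictlyIncreasing⇒injective σ↑) (_∘ strictlyIncreasing⇒injective σ↑) a≢j⊎b≢j)
    ; at        = at δ
    }

  det-principal-AddAt : ∀ {k n} {x : Fin n} {j : Fin (suc k)} {t} {M M′ : Matrix n}
                          {σ : Fin (suc k) → Fin n} →
                        AddAt x x t M M′ → StrictlyIncreasing σ → σ j ≡ x →
                        det (principal M′ σ) ≡ det (principal M σ) + t * det (principal M (σ ∘ punchIn j))
  det-principal-AddAt δ σ↑ σj≡x = det-AddAt-diagonal (principal-AddAt δ σ↑ σj≡x)

  det-principal-AddAt-avoiding : ∀ {k n} {x : Fin n} {t} {M M′ : Matrix n} {σ : Fin k → Fin n} →
                                 AddAt x x t M M′ → (∀ j → σ j ≢ x) →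
                                 det (principal M′ σ) ≡ det (principal M σ)
  det-principal-AddAt-avoiding δ σ∌x = det-cong (λ a b → elsewhere δ _ _ (inj₁ (σ∌x a)))

module DiagonalShifts (R : RealField) where
  open RealField R
  open Over R
  open RealFieldProperties R
  open IndexSelections R
  open Determinants R

  _+diag_ : ∀ {m} → Matrix m → (Fin m → Carrier) → Matrix m
  (M +diag d) i j with i Fin.≟ j
  ... | yes _ = M i j + d i
  ... | no  _ = M i j

  _-diag_ : ∀ {m} → Matrix m → (Fin m → Carrier) → Matrix m
  M -diag d = M +diag (λ i → - d i)

  +diag-diagonal : ∀ {m} (M : Matrix m) d i → (M +diag d) i i ≡ M i i + d i
  +diag-diagonal M d i with i Fin.≟ i
  ... | yes _   = refl
  ... | no i≢i = contradiction refl i≢i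

  +diag-offDiagonal : ∀ {m} (M : Matrix m) d {i j} → i ≢ j → (M +diag d) i j ≡ M i j
  +diag-offDiagonal M d {i} {j} i≢j with i Fin.≟ j
  ... | yes i≡j = contradiction i≡j i≢j
  ... | no  _   = refl

  +diag-zero : ∀ {m} (M : Matrix m) {d} → (∀ i → d i ≡ 0#) → ∀ i j → (M +diag d) i j ≡ M i j
  +diag-zero M {d} d≡0 i j with i Fin.≟ j
  ... | yes _ = trans (cong (M i j +_) (d≡0 i)) (+-identityʳ (M i j))
  ... | no  _ = refl

  +diag-AddAt : ∀ {m} {M : Matrix m} {d d′ x t} → (∀ i → i ≢ x → d′ i ≡ d i) → d′ x ≡ d x + t →
                AddAt x x t (M +diag d) (M +diag d′)
  +diag-AddAt {M = M} {d} {d′} {x} {t} d′≗d d′x = record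
    { elsewhere = unchanged
    ; at        = begin
        (M +diag d′) x x    ≡⟨ +diag-diagonal M d′ x ⟩
        M x x + d′ x        ≡⟨ cong (M x x +_) d′x ⟩
        M x x + (d x + t)   ≡⟨ sym (+-assoc _ _ _) ⟩
        M x x + d x + t     ≡⟨ cong (_+ t) (sym (+diag-diagonal M d x)) ⟩
        (M +diag d) x x + t ∎
    }
    where
      open ≡-Reasoning
      unchanged : ∀ k l → k ≢ x ⊎ l ≢ x → (M +diag d′) k l ≡ (M +diag d) k l
      unchanged k l k≢x⊎l≢x with k Fin.≟ l
      ... | yes refl = cong (M k k +_) (d′≗d k (reduce k≢x⊎l≢x))
      ... | no  _    = refl

  principal-+diag : ∀ {k m} (M : Matrix m) d {σ : Fin k → Fin m} → (∀ {a b} → σ a ≡ σ b → a ≡ b) →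
                    ∀ a b → principal (M +diag d) σ a b ≡ (principal M σ +diag (d ∘ σ)) a b
  principal-+diag M d {σ} σ-inj a b with a Fin.≟ b
  ... | yes refl = +diag-diagonal M d (σ a)
  ... | no  a≢b  = +diag-offDiagonal M d (a≢b ∘ σ-inj)

  IsP0 : ∀ {m} → Matrix m → Set
  IsP0 {m} M = ∀ k (τ : Fin k → Fin m) → StrictlyIncreasing τ → 0# ≤ det (principal M τ)

  IsP0-resp : ∀ {m} {M N : Matrix m} → (∀ i j → M i j ≡ N i j) → IsP0 M → IsP0 N
  IsP0-resp M≗N p0 k τ τ↑ = subst (0# ≤_) (det-cong (λ a b → M≗N (τ a) (τ b))) (p0 k τ τ↑)

  IsP0-principal : ∀ {k m} {M : Matrix m} {σ : Fin k → Fin m} →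
                   StrictlyIncreasing σ → IsP0 M → IsP0 (principal M σ)
  IsP0-principal σ↑ p0 k τ τ↑ = p0 k _ (strictlyIncreasing-∘ σ↑ τ↑)

  IsP0-AddAt : ∀ {m} {M M′ : Matrix m} {x t} → AddAt x x t M M′ → 0# ≤ t → IsP0 M → IsP0 M′
  IsP0-AddAt δ 0≤t p0 zero    τ τ↑ = inj₁ 0<1
  IsP0-AddAt {x = x} δ 0≤t p0 (suc k) τ τ↑ with Fin.any? (λ j → τ j Fin.≟ x)
  ... | yes (j , τj≡x) = subst (0# ≤_) (sym (det-principal-AddAt δ τ↑ τj≡x))
          (+-nonNeg (p0 _ τ τ↑) (*-nonNeg 0≤t (p0 k _ (strictlyIncreasing-∘ τ↑ (strictlyIncreasing-punchIn j)))))
  ... | no τ∌x = subst (0# ≤_) (sym (det-principal-AddAt-avoiding δ (λ j τj≡x → τ∌x (j , τj≡x))))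
                   (p0 _ τ τ↑)

  IsP0-+diag-supported : ∀ {m} {M : Matrix m} → IsP0 M → ∀ xs {d} → (∀ i → 0# ≤ d i) →
                         (∀ i → i ∉ xs → d i ≡ 0#) → IsP0 (M +diag d)
  IsP0-+diag-supported {M = M} p0 [] d≥0 d⊆[] =
    IsP0-resp (λ i j → sym (+diag-zero M (λ i → d⊆[] i (λ ())) i j)) p0
  IsP0-+diag-supported p0 (x ∷ xs) {d} d≥0 d⊆x∷xs = IsP0-AddAt
    (+diag-AddAt (λ i i≢x → sym (updateAt-minimal i x d i≢x))
                 (trans (sym (+-identityˡ (d x))) (cong (_+ d x) (sym (updateAt-updates x d)))))
    (d≥0 x)
    (IsP0-+diag-supported p0 xs d₀≥0 d₀⊆xs)
    where
      d₀ = updateAt d x (const 0#)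
      d₀≥0 : ∀ i → 0# ≤ d₀ i
      d₀≥0 i with i Fin.≟ x
      ... | yes refl = inj₂ (sym (updateAt-updates x d))
      ... | no  i≢x  = subst (0# ≤_) (sym (updateAt-minimal i x d i≢x)) (d≥0 i)
      d₀⊆xs : ∀ i → i ∉ xs → d₀ i ≡ 0#
      d₀⊆xs i i∉xs with i Fin.≟ x
      ... | yes refl = updateAt-updates x d
      ... | no  i≢x  = trans (updateAt-minimal i x d i≢x)
                             (d⊆x∷xs i λ { (here i≡x) → i≢x i≡x ; (there i∈xs) → i∉xs i∈xs })

  IsP0-+diag : ∀ {m} {M : Matrix m} {d} → IsP0 M → (∀ i → 0# ≤ d i) → IsP0 (M +diag d)
  IsP0-+diag {m} p0 d≥0 = IsP0-+diag-supported p0 (allFin m) d≥0 (λ i i∉ → contradiction (∈-allFin i) i∉)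

  det-+diag-pos : ∀ {m} {M : Matrix m} {d} → IsP0 M → (∀ i → 0# < d i) → 0# < det (M +diag d)
  det-+diag-pos {zero}          p0 d>0 = 0<1
  det-+diag-pos {suc m} {M} {d} p0 d>0 =
    subst (0# <_) (sym expand) (+-nonNeg-pos rest (*-pos (d>0 zero) corner))
    where
      d₀ : Fin (suc m) → Carrier
      d₀ = updateAt d zero (const 0#)
      expand : det (M +diag d) ≡ det (M +diag d₀) + d zero * det (dropRowCol zero zero (M +diag d₀))
      expand = det-AddAt-diagonal {M = M +diag d₀} {M +diag d}
                 (+diag-AddAt (λ i i≢0 → sym (updateAt-minimal i zero d i≢0)) (sym (+-identityˡ (d zero))))
      rest : 0# ≤ det (M +diag d₀)
      rest = IsP0-+diag p0 (λ { zero → inj₂ refl ; (suc i) → inj₁ (d>0 (suc i)) }) (suc m) id strictlyIncreasing-id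
      corner : 0# < det (dropRowCol zero zero (M +diag d₀))
      corner = subst (0# <_)
        (sym (det-cong {M = principal (M +diag d₀) suc} (principal-+diag M d₀ {σ = suc} Fin.suc-injective)))
        (det-+diag-pos {M = principal M suc} {d ∘ suc}
          (IsP0-principal {M = M} {σ = suc} (strictlyIncreasing-punchIn zero) p0) (d>0 ∘ suc))

  IsP0⇒IsP-+diag : ∀ {m} {M : Matrix m} {d} → IsP0 M → (∀ i → 0# < d i) → IsP (M +diag d)
  IsP0⇒IsP-+diag {M = M} {d} p0 d>0 k σ σ↑ =
    subst (0# <_) (sym (det-cong (principal-+diag M d (strictlyIncreasing⇒injective σ↑))))
      (det-+diag-pos (IsP0-principal {M = M} σ↑ p0) (d>0 ∘ σ))

  IsP0+⇒IsP0 : ∀ {m} {M : Matrix m} → IsP0+ M → IsP0 M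
  IsP0+⇒IsP0 p0+ zero    τ τ↑ = inj₁ 0<1
  IsP0+⇒IsP0 p0+ (suc k) τ τ↑ = proj₁ (p0+ k (strictlyIncreasing⇒≤ τ↑)) τ τ↑

  IsP⇒IsP0+ : ∀ {m} {M : Matrix m} → IsP M → IsP0+ M
  IsP⇒IsP0+ p k k<m =
    (λ σ σ↑ → inj₁ (p k σ σ↑)) ,
    (λ i → inject≤ i k<m) , strictlyIncreasing-inject≤ k<m , p k _ (strictlyIncreasing-inject≤ k<m)

module PartialMatrices (R : RealField) where
  open RealField R
  open Over R
  open RealFieldProperties R
  open SmallParameters R
  open IndexSelections R
  open Determinants R
  open DiagonalShifts R

  SignSymmetric-resp-offDiagonal : ∀ {n} {M M′ : Matrix n} → (∀ {i j} → i ≢ j → M′ i j ≡ M i j) →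
                                   SignSymmetric M → SignSymmetric M′
  SignSymmetric-resp-offDiagonal M′≗M ss i j i≢j =
    subst₂ TwinOK (sym (M′≗M i≢j)) (sym (M′≗M (i≢j ∘ sym))) (ss i j i≢j)

  module _ {n} (D : Digraph n) where

    PositiveMinors : Matrix n → Set
    PositiveMinors A = ∀ k (σ : Fin k → Fin n) → StrictlyIncreasing σ → FullySpecified D σ →
                       0# < det (principal A σ)

    PositiveMinors-resp : ∀ {A A′} → (∀ i j → A i j ≡ A′ i j) → PositiveMinors A → PositiveMinors A′
    PositiveMinors-resp A≗A′ pos k σ σ↑ σ∈D =
      subst (0# <_) (det-cong (λ a b → A≗A′ (σ a) (σ b))) (pos k σ σ↑ σ∈D)

    PartialSSP⇒PositiveMinors : ∀ {A} → PartialSSP D A → PositiveMinors A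
    PartialSSP⇒PositiveMinors _              zero    σ σ↑ σ∈D = 0<1
    PartialSSP⇒PositiveMinors (principals , _) (suc k) σ σ↑ σ∈D =
      proj₂ (principals _ σ σ↑ σ∈D) k id strictlyIncreasing-id

    PositiveMinors⇒IsP : ∀ {A} → AllSpecified D → PositiveMinors A → IsP A
    PositiveMinors⇒IsP all pos k σ σ↑ = pos (suc k) σ σ↑ (λ a b → all (σ a) (σ b))

    MinorSurvives : Matrix n → Fin n → ∀ k → (Fin k → Fin n) → Carrier → Set
    MinorSurvives A x k σ ε = ∀ {A′} → AddAt x x (- ε) A A′ → StrictlyIncreasing σ → FullySpecified D σ →
                              0# < det (principal A′ σ)

    eventually-MinorSurvives : ∀ {A} → PositiveMinors A → ∀ x k σ → Eventually (MinorSurvives A x k σ)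
    eventually-MinorSurvives pos x zero σ = eventually-always (λ _ {_} _ _ _ → 0<1)
    eventually-MinorSurvives {A} pos x (suc k) σ with Fin.any? (λ j → σ j Fin.≟ x)
    ... | yes (j , σj≡x) = eventually-map
      (λ 0<big-ε*small {_} δ σ↑ σ∈D → subst (0# <_) (sym (det-principal-AddAt δ σ↑ σj≡x))
         (0<big-ε*small (pos _ σ σ↑ σ∈D)
                        (pos k (σ ∘ punchIn j) (strictlyIncreasing-∘ σ↑ (strictlyIncreasing-punchIn j))
                             (λ a b → σ∈D _ _))))
      (eventually-0<x-εy (det (principal A σ)) (det (principal A (σ ∘ punchIn j))))
    ... | no σ∌x = eventually-always (λ _ {_} δ σ↑ σ∈D →
      subst (0# <_) (sym (det-principal-AddAt-avoiding δ (λ j σj≡x → σ∌x (j , σj≡x)))) (pos _ σ σ↑ σ∈D))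

    MinorSurvives-resp : ∀ {A x k σ τ ε} → (∀ i → σ i ≡ τ i) →
                         MinorSurvives A x k σ ε → MinorSurvives A x k τ ε
    MinorSurvives-resp {A} σ≗τ survives {A′} δ τ↑ τ∈D =
      subst (0# <_) (det-cong (λ a b → cong₂ A′ (σ≗τ a) (σ≗τ b)))
        (survives δ (strictlyIncreasing-resp-≗ (sym ∘ σ≗τ) τ↑)
                    (fullySpecified-resp-≗ {D = D} (sym ∘ σ≗τ) τ∈D))

    eventually-PositiveMinors-AddAt : ∀ {A} → PositiveMinors A → ∀ x →
      Eventually (λ ε → ∀ {A′} → AddAt x x (- ε) A A′ → PositiveMinors A′)
    eventually-PositiveMinors-AddAt pos x = eventually-map
      (λ survives {_} δ k σ σ↑ σ∈D → survives k (s≤s (strictlyIncreasing⇒≤ σ↑)) σ δ σ↑ σ∈D)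
      (eventually-∀< (suc n) λ k →
        eventually-∀Fin→Fin k MinorSurvives-resp (eventually-MinorSurvives pos x k))

    shrinkDiagonalAt : ∀ {A d} x → PositiveMinors (A -diag d) →
                       ∃[ ε ] (0# < ε × PositiveMinors (A -diag updateAt d x (_+ ε)))
    shrinkDiagonalAt {d = d} x pos =
      let ε , 0<ε , survives = eventually-witness (eventually-PositiveMinors-AddAt pos x)
      in  ε , 0<ε , survives (+diag-AddAt (λ i i≢x → cong -_ (updateAt-minimal i x d i≢x))
                                          (trans (cong -_ (updateAt-updates x d)) (-‿+ (d x) ε)))

    shrinkDiagonalOn : ∀ {A} → PositiveMinors A → (xs : List (Fin n)) →
      ∃[ d ] ((∀ i → 0# ≤ d i) × (∀ {i} → i ∈ xs → 0# < d i) × PositiveMinors (A -diag d))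
    shrinkDiagonalOn {A} pos [] =
      const 0# , (λ _ → inj₂ refl) , (λ ()) ,
      PositiveMinors-resp (λ i j → sym (+diag-zero A (λ _ → ε⁻¹≈ε) i j)) pos
    shrinkDiagonalOn {A} pos (x ∷ xs) with shrinkDiagonalOn pos xs
    ... | d , d≥0 , d>0 , pos-d = extend (shrinkDiagonalAt x pos-d)
      where
        extend : ∃[ ε ] (0# < ε × PositiveMinors (A -diag updateAt d x (_+ ε))) →
                 ∃[ d′ ] ((∀ i → 0# ≤ d′ i) × (∀ {i} → i ∈ x ∷ xs → 0# < d′ i) ×
                          PositiveMinors (A -diag d′))
        extend (ε , 0<ε , pos-d′) = updateAt d x (_+ ε) , d′≥0 , d′>0 , pos-d′
          where
            0<d′x : 0# < updateAt d x (_+ ε) x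
            0<d′x = subst (0# <_) (sym (updateAt-updates x d)) (+-nonNeg-pos (d≥0 x) 0<ε)
            d′≥0 : ∀ i → 0# ≤ updateAt d x (_+ ε) i
            d′≥0 i with i Fin.≟ x
            ... | yes refl = inj₁ 0<d′x
            ... | no  i≢x  = subst (0# ≤_) (sym (updateAt-minimal i x d i≢x)) (d≥0 i)
            d′>0 : ∀ {i} → i ∈ x ∷ xs → 0# < updateAt d x (_+ ε) i
            d′>0 (here refl) = 0<d′x
            d′>0 {i} (there i∈xs) with i Fin.≟ x
            ... | yes refl = 0<d′x
            ... | no  i≢x  = subst (0# <_) (sym (updateAt-minimal i x d i≢x)) (d>0 i∈xs)

    shrinkDiagonal : ∀ {A} → PositiveMinors A → ∃[ d ] ((∀ i → 0# < d i) × PositiveMinors (A -diag d))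
    shrinkDiagonal pos =
      let d , _ , d>0 , posd = shrinkDiagonalOn pos (allFin n) in d , (λ i → d>0 (∈-allFin i)) , posd

    TwinsOK-resp-offDiagonal : ∀ {M M′ : Matrix n} → (∀ {i j} → i ≢ j → M′ i j ≡ M i j) →
                               TwinsOK D M → TwinsOK D M′
    TwinsOK-resp-offDiagonal M′≗M twins i j i≢j ij∈D ji∈D =
      subst₂ TwinOK (sym (M′≗M i≢j)) (sym (M′≗M (i≢j ∘ sym))) (twins i j i≢j ij∈D ji∈D)

    -diag-PartialSSP0+ : ∀ {A d} → PartialSSP D A → PositiveMinors (A -diag d) → PartialSSP0+ D (A -diag d)
    -diag-PartialSSP0+ {A} {d} (principals , twins) pos =
        (λ k σ σ↑ σ∈D → inj₁ (pos (suc k) σ σ↑ σ∈D))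
      , TwinsOK-resp-offDiagonal (+diag-offDiagonal A _) twins
      , λ all → SignSymmetric-resp-offDiagonal (+diag-offDiagonal A _)
                  (proj₁ (principals n id strictlyIncreasing-id all))
              , IsP⇒IsP0+ {M = A -diag d} (PositiveMinors⇒IsP {A -diag d} all pos)

    -- Matching on i ≟ j also reduces the goal's (B +diag d) i j.
    +diag-completes : ∀ {A B d} → Completion D (A -diag d) B → Completion D A (B +diag d)
    +diag-completes {A} {B} {d} B⊇A-d i j ij∈D with i Fin.≟ j
    ... | yes refl = begin
      B i i + d i          ≡⟨ cong (_+ d i) (trans (B⊇A-d i i ij∈D) (+diag-diagonal A _ i)) ⟩
      A i i + - d i + d i  ≡⟨ solve 2 (λ a x → a :- x :+ x := a) refl (A i i) (d i) ⟩
      A i i                ∎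
      where open ≡-Reasoning
    ... | no i≢j = trans (B⊇A-d i j ij∈D) (+diag-offDiagonal A _ i≢j)

corollary4p6 : (R : RealField) (n : ℕ) (D : Over.Digraph R n) →
    Over.HasSSP0+Completion R D → Over.HasSSPCompletion R D
corollary4p6 R n D = hasSSPCompletion
  where
    open Over R
    open DiagonalShifts R
    open PartialMatrices R

    hasSSPCompletion : HasSSP0+Completion D → HasSSPCompletion D
    hasSSPCompletion hasSSP0+ A partialSSP =
      let d , d>0 , shrunkPositive = shrinkDiagonal D {A} (PartialSSP⇒PositiveMinors D partialSSP)
          B , B⊇A-d , B-signSymmetric , B-P0+ =
            hasSSP0+ (A -diag d) (-diag-PartialSSP0+ D partialSSP shrunkPositive)
      in  B +diag d
        , +diag-completes D B⊇A-d
        , SignSymmetric-resp-offDiagonal (+diag-offDiagonal B d) B-signSymmetric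
        , IsP0⇒IsP-+diag (IsP0+⇒IsP0 {M = B} B-P0+) d>0
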